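{- Let $A$ be a downset. If $\pi$ is a separable permutation that is $A$-critical, then $\pi$ has length $|A|$. In particular, if $\pi$ is separable and $k$-critical, then $\pi$ has length $\binom{k+2}{2}$; and if $\pi$ is separable and $(r,s)$-critical, then $\pi$ has length $(r+1)(s+1)$.
   Context: A permutation of length $n\ge0$ is a bijection $\pi$ of $[n]$, written as $\pi(1)\ldots\pi(n)$. $\pi$ contains $\tau$ ($\tau$ is a pattern of $\pi$) if $\pi$ has a subsequence in the same relative order as $\tau$; proper if $\tau$ is shorter than $\pi$. $\mathbb N=\{0,1,2,\dots\}$. For $r,s\in\mathbb N$, $\pi$ is $(r,s)$-coverable if its terms can be partitioned into $r$ increasing and $s$ decreasing (possibly empty) subsequences; $k$-coverable if $(r,s)$-coverable for some $r+s=k$; $(r,s)$-critical (resp. $k$-critical) if not $(r,s)$-coverable (resp. $k$-coverable) but every proper pattern is. A downset is a finite subset $A\subseteq\mathbb N^2$ such that $(r,s)\in A$, $r'\le r$, $s'\le s$ imply $(r',s')\in A$. $\pi$ is $A$-coverable if it is $(r,s)$-coverable for some $(r,s)\in A$, and $A$-critical if it is not $A$-coverable but every proper pattern is $A$-coverable. For permutations $\pi$ of length $n$ and $\sigma$ of length $m$: $\pi\oplus\sigma=\pi(1)\ldots\pi(n),\ \sigma(1)+n\ldots\sigma(m)+n$ and $\pi\ominus\sigma=\pi(1)+m\ldots\pi(n)+m,\ \sigma(1)\ldots\sigma(m)$. A permutation is separable if it can be obtained from the length-one permutation $(1)$ by repeatedly taking direct sums and skew sums. -}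

module Defs where

open import Data.Nat using (ℕ; zero; suc; _+_; _<_; _≤_; _>_)
open import Data.Fin as Fin using (Fin)
open import Data.List using (List; []; _∷_; _++_; map; length; lookup; upTo; [_])
open import Data.List.Relation.Binary.Permutation.Propositional using (_↭_)
open import Data.List.Relation.Unary.Unique.Propositional using (Unique)
open import Data.List.Membership.Propositional using (_∈_)
open import Data.Product using (Σ; ∃; _×_; _,_)
open import Data.Sum using (_⊎_; inj₁; inj₂)
open import Relation.Binary.PropositionalEquality using (_≡_)
open import Relation.Nullary using (¬_)
open import Function.Bundles using (_⇔_)

IsPerm : List ℕ → Set
IsPerm π = π ↭ map suc (upTo (length π))

record Perm : Set where
  constructor perm
  field
    word   : List ℕ
    isPerm : IsPerm word
open Perm public

len : Perm → ℕ
len π = length (word π)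

_at_ : (π : Perm) → Fin (len π) → ℕ
π at i = lookup (word π) i

Contains : Perm → Perm → Set
Contains π τ =
  Σ (Fin (len τ) → Fin (len π)) λ e →
    (∀ i j → i Fin.< j → e i Fin.< e j) ×
    (∀ i j → ((τ at i) < (τ at j)) ⇔ ((π at e i) < (π at e j)))

Coverable : ℕ → ℕ → Perm → Set
Coverable r s π =
  Σ (Fin (len π) → Fin r ⊎ Fin s) λ c →
    ∀ i j → i Fin.< j →
      (∀ a → c i ≡ inj₁ a → c j ≡ inj₁ a → (π at i) < (π at j)) ×
      (∀ b → c i ≡ inj₂ b → c j ≡ inj₂ b → (π at i) > (π at j))

KCoverable : ℕ → Perm → Set
KCoverable k π = ∃ λ r → ∃ λ s → r + s ≡ k × Coverable r s π

record Downset : Set where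
  field
    elems  : List (ℕ × ℕ)
    unique : Unique elems
    closed : ∀ r s r' s' → (r , s) ∈ elems → r' ≤ r → s' ≤ s → (r' , s') ∈ elems
open Downset public

card : Downset → ℕ
card A = length (elems A)

ACoverable : Downset → Perm → Set
ACoverable A π = ∃ λ r → ∃ λ s → (r , s) ∈ elems A × Coverable r s π

Critical : (Perm → Set) → Perm → Set
Critical P π = ¬ P π × (∀ τ → len τ < len π → Contains π τ → P τ)

ACritical : Downset → Perm → Set
ACritical A = Critical (ACoverable A)

KCritical : ℕ → Perm → Set
KCritical k = Critical (KCoverable k)

RSCritical : ℕ → ℕ → Perm → Set
RSCritical r s = Critical (Coverable r s)

_⊕_ : List ℕ → List ℕ → List ℕ
π ⊕ σ = π ++ map (length π +_) σ

_⊖_ : List ℕ → List ℕ → List ℕ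
π ⊖ σ = map (length σ +_) π ++ σ

data SeparableW : List ℕ → Set where
  one  : SeparableW [ 1 ]
  sum  : ∀ {π σ} → SeparableW π → SeparableW σ → SeparableW (π ⊕ σ)
  skew : ∀ {π σ} → SeparableW π → SeparableW σ → SeparableW (π ⊖ σ)

Separable : Perm → Set
Separable π = SeparableW (word π)

-- A separable permutation is the word of a tree of direct and skew sums.  For such a word the
-- least number minDec t r of decreasing sequences needed next to r increasing ones is additive
-- over ⊞, the least number minInc t s of increasing ones is additive over ⊟, and the two are
-- conjugate partitions.  So the pairs (r , s) for which the word is not (r , s)-coverable form
-- a Young diagram with exactly as many cells as the word has points.  If π is A-critical, A
-- lies inside this diagram.  If some cell were outside A, there would be a corner of the
-- diagram outside A, and a point of the word can be deleted so that the diagram loses just that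
-- corner; the resulting proper pattern would still not be A-coverable.  Hence the diagram is A.

module Submission where

open import Defs
open import Data.Empty using (⊥-elim)
open import Data.Fin as Fin using (Fin; toℕ; fromℕ<)
open import Data.Fin.Properties using (toℕ-fromℕ<; toℕ<n; toℕ-injective; any?)
open import Data.List using (List; []; _∷_; _++_; map; length; lookup; upTo; applyUpTo; [_]; filter)
open import Data.List.Properties using (length-++; length-map; length-upTo; map-upTo; map-applyUpTo)
open import Data.List.Membership.Propositional using (_∈_)
open import Data.List.Membership.Propositional.Properties
  using (∈-applyUpTo⁻; ∈-upTo⁺; ∈-upTo⁻; ∈-filter⁺; ∈-length; ∈-++⁻; ∈-++⁺ˡ; ∈-++⁺ʳ; ∈-map⁺; ∈-map⁻; ∈-∃++)
open import Data.List.Relation.Binary.Permutation.Propositional using (_↭_; ↭-refl; ↭-trans; ↭-reflexive)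
import Data.List.Relation.Binary.Permutation.Propositional.Properties as ↭
open import Data.List.Relation.Binary.Subset.Propositional using (_⊆_)
open import Data.List.Relation.Unary.All as All using ([])
open import Data.List.Relation.Unary.AllPairs using ([]; _∷_)
open import Data.List.Relation.Unary.Any using (here; there)
open import Data.List.Relation.Unary.Unique.Propositional using (Unique)
import Data.List.Relation.Unary.Unique.Propositional.Properties as Unique
open import Data.Nat using (ℕ; zero; suc; _+_; _*_; _∸_; _≤_; _<_; _>_; z≤n; s≤s; s≤s⁻¹; _<?_; _≟_)
open import Data.Nat.Combinatorics using (_C_; nC1≡n; nCk+nC[k+1]≡[n+1]C[k+1])
open import Data.Nat.Properties
open import Data.Product as Product using (∃; _×_; _,_; _,′_; proj₁; proj₂)
open import Data.Product.Properties using () renaming (≡-dec to ×-≡-dec)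
open import Data.Sum as Sum using (_⊎_; inj₁; inj₂; swap; map₂)
open import Data.Sum.Properties using (≡-dec)
open import Data.Unit using (⊤; tt)
open import Function using (_∘_; flip)
open import Function.Bundles using (_⇔_; mk⇔; Equivalence)
open import Function.Properties.Equivalence using () renaming (sym to ⇔-sym; trans to ⇔-trans)
open import Level using (0ℓ)
open import Relation.Binary.Core using (Rel; _⇒_)
open import Relation.Binary.PropositionalEquality hiding ([_])
open import Relation.Nullary using (¬_; yes; no; contradiction; ¬?)
open import Relation.Unary using (Decidable)

open Equivalence using (to; from)
open import Data.List.Membership.DecPropositional (×-≡-dec _≟_ _≟_) using (_∈?_)

infixl 9 _!_
-- Total indexing: out-of-range positions read as 0; every use below is in range.
_!_ : List ℕ → ℕ → ℕ
[] ! i = 0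
(x ∷ xs) ! zero = x
(x ∷ xs) ! suc i = xs ! i

!-++ˡ : ∀ xs ys {i} → i < length xs → (xs ++ ys) ! i ≡ xs ! i
!-++ˡ (x ∷ xs) ys {zero} _ = refl
!-++ˡ (x ∷ xs) ys {suc i} (s≤s i<n) = !-++ˡ xs ys i<n

!-++ʳ : ∀ xs ys i → (xs ++ ys) ! (length xs + i) ≡ ys ! i
!-++ʳ [] ys i = refl
!-++ʳ (x ∷ xs) ys i = !-++ʳ xs ys i

!-map : ∀ f xs {i} → i < length xs → map f xs ! i ≡ f (xs ! i)
!-map f (x ∷ xs) {zero} _ = refl
!-map f (x ∷ xs) {suc i} (s≤s i<n) = !-map f xs i<n

!-∈ : ∀ xs {i} → i < length xs → xs ! i ∈ xs
!-∈ (x ∷ xs) {zero} _ = here refl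
!-∈ (x ∷ xs) {suc i} (s≤s i<n) = there (!-∈ xs i<n)

lookup≡! : ∀ xs (i : Fin (length xs)) → lookup xs i ≡ xs ! toℕ i
lookup≡! (x ∷ xs) Fin.zero = refl
lookup≡! (x ∷ xs) (Fin.suc i) = lookup≡! xs i

length-map-< : ∀ {f : ℕ → ℕ} xs {i} → i < length (map f xs) → i < length xs
length-map-< {f} xs {i} = subst (i <_) (length-map f xs)

-- The empty tree arises when the only point of a tree is deleted.
data Tree : Set where
  empty single : Tree
  _⊞_ _⊟_ : Tree → Tree → Tree

wordOf : Tree → List ℕ
wordOf empty = []
wordOf single = [ 1 ]
wordOf (x ⊞ y) = wordOf x ⊕ wordOf y
wordOf (x ⊟ y) = wordOf x ⊖ wordOf y

size : Tree → ℕ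
size empty = 0
size single = 1
size (x ⊞ y) = size x + size y
size (x ⊟ y) = size x + size y

length-wordOf : ∀ t → length (wordOf t) ≡ size t
length-wordOf empty = refl
length-wordOf single = refl
length-wordOf (x ⊞ y) = begin
  length (wordOf x ++ map _ (wordOf y))            ≡⟨ length-++ (wordOf x) ⟩
  length (wordOf x) + length (map _ (wordOf y))    ≡⟨ cong₂ _+_ (length-wordOf x) (length-map _ (wordOf y)) ⟩
  size x + length (wordOf y)                        ≡⟨ cong (size x +_) (length-wordOf y) ⟩
  size (x ⊞ y)                                      ∎
  where open ≡-Reasoning
length-wordOf (x ⊟ y) = begin
  length (map _ (wordOf x) ++ wordOf y)            ≡⟨ length-++ (map _ (wordOf x)) ⟩
  length (map _ (wordOf x)) + length (wordOf y)    ≡⟨ cong₂ _+_ (length-map _ (wordOf x)) (length-wordOf y) ⟩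
  length (wordOf x) + size y                        ≡⟨ cong (_+ size y) (length-wordOf x) ⟩
  size (x ⊟ y)                                      ∎
  where open ≡-Reasoning

separable⇒tree : ∀ {u} → SeparableW u → ∃ λ t → wordOf t ≡ u
separable⇒tree one = single , refl
separable⇒tree (sum p q) with separable⇒tree p | separable⇒tree q
... | x , refl | y , refl = x ⊞ y , refl
separable⇒tree (skew p q) with separable⇒tree p | separable⇒tree q
... | x , refl | y , refl = x ⊟ y , refl

applyUpTo-+ : ∀ (f : ℕ → ℕ) m n → applyUpTo f (m + n) ≡ applyUpTo f m ++ applyUpTo (λ k → f (m + k)) n
applyUpTo-+ f zero n = refl
applyUpTo-+ f (suc m) n = cong (f 0 ∷_) (applyUpTo-+ (f ∘ suc) m n)

applyUpTo-cong : ∀ {f g : ℕ → ℕ} → (∀ k → f k ≡ g k) → ∀ n → applyUpTo f n ≡ applyUpTo g n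
applyUpTo-cong f≗g zero = refl
applyUpTo-cong f≗g (suc n) = cong₂ _∷_ (f≗g 0) (applyUpTo-cong (f≗g ∘ suc) n)

applyUpTo-suc-+ : ∀ m n → applyUpTo suc (m + n) ≡ applyUpTo suc m ++ map (m +_) (applyUpTo suc n)
applyUpTo-suc-+ m n = begin
  applyUpTo suc (m + n)                                  ≡⟨ applyUpTo-+ suc m n ⟩
  applyUpTo suc m ++ applyUpTo (λ k → suc (m + k)) n     ≡⟨ cong (applyUpTo suc m ++_) (applyUpTo-cong (sym ∘ +-suc m) n) ⟩
  applyUpTo suc m ++ applyUpTo (λ k → m + suc k) n       ≡⟨ cong (applyUpTo suc m ++_) (map-applyUpTo suc (m +_) n) ⟨
  applyUpTo suc m ++ map (m +_) (applyUpTo suc n)        ∎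
  where open ≡-Reasoning

++-shift-↭ : ∀ {u v} m n → u ↭ applyUpTo suc m → v ↭ applyUpTo suc n →
             u ++ map (m +_) v ↭ applyUpTo suc (m + n)
++-shift-↭ m n u↭ v↭ = ↭-trans (↭.++⁺ u↭ (↭.map⁺ (m +_) v↭)) (↭-reflexive (sym (applyUpTo-suc-+ m n)))

wordOf-↭ : ∀ t → wordOf t ↭ applyUpTo suc (size t)
wordOf-↭ empty = ↭-refl
wordOf-↭ single = ↭-refl
wordOf-↭ (x ⊞ y) rewrite length-wordOf x = ++-shift-↭ (size x) (size y) (wordOf-↭ x) (wordOf-↭ y)
wordOf-↭ (x ⊟ y) rewrite length-wordOf y | +-comm (size x) (size y) =
  ↭-trans (↭.++-comm (map (size y +_) (wordOf x)) (wordOf y))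
          (++-shift-↭ (size y) (size x) (wordOf-↭ y) (wordOf-↭ x))

treePerm : Tree → Perm
treePerm t = perm (wordOf t) (subst (wordOf t ↭_) eq (wordOf-↭ t))
  where
  eq : applyUpTo suc (size t) ≡ map suc (upTo (length (wordOf t)))
  eq rewrite length-wordOf t = sym (map-upTo suc (size t))

wordOf-!-range : ∀ t {i} → i < size t → 0 < wordOf t ! i × wordOf t ! i ≤ size t
wordOf-!-range t {i} i<n
  with ∈-applyUpTo⁻ suc (↭.∈-resp-↭ (wordOf-↭ t) (!-∈ (wordOf t) (subst (i <_) (sym (length-wordOf t)) i<n)))
... | k , k<n , eq rewrite eq = s≤s z≤n , k<n

record Embedding (u v : List ℕ) : Set where
  field
    index      : ℕ → ℕ
    increasing : ∀ {i j} → i < j → j < length u → index i < index j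
    in-range   : ∀ {i} → i < length u → index i < length v
    order      : ∀ {i j} → i < length u → j < length u →
                 (u ! i < u ! j) ⇔ (v ! index i < v ! index j)
open Embedding

embedding⇒contains : ∀ π τ → Embedding (word τ) (word π) → Contains π τ
embedding⇒contains π τ E = e , increasing′ , order′
  where
  e : Fin (len τ) → Fin (len π)
  e i = fromℕ< (in-range E (toℕ<n i))
  π-at-e : ∀ i → π at e i ≡ word π ! index E (toℕ i)
  π-at-e i = trans (lookup≡! (word π) (e i)) (cong (word π !_) (toℕ-fromℕ< _))
  increasing′ : ∀ i j → i Fin.< j → e i Fin.< e j
  increasing′ i j i<j = subst₂ _<_ (sym (toℕ-fromℕ< _)) (sym (toℕ-fromℕ< _)) (increasing E i<j (toℕ<n j))
  order′ : ∀ i j → (τ at i < τ at j) ⇔ (π at e i < π at e j)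
  order′ i j = subst₂ _⇔_ (sym (cong₂ _<_ (lookup≡! (word τ) i) (lookup≡! (word τ) j)))
                          (sym (cong₂ _<_ (π-at-e i) (π-at-e j)))
                          (order E (toℕ<n i) (toℕ<n j))

data SplitIndex (n₁ n₂ i : ℕ) : Set where
  left  : i < n₁ → SplitIndex n₁ n₂ i
  right : ∀ k → k < n₂ → i ≡ n₁ + k → SplitIndex n₁ n₂ i

splitIndex : ∀ n₁ n₂ i → i < n₁ + n₂ → SplitIndex n₁ n₂ i
splitIndex n₁ n₂ i i<n with i <? n₁
... | yes i<n₁ = left i<n₁
... | no i≮n₁ = right (i ∸ n₁) (+-cancelˡ-< n₁ _ _ (subst (_< n₁ + n₂) (sym eq) i<n)) (sym eq)
  where eq = m+[n∸m]≡n (≮⇒≥ i≮n₁)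

glue : ∀ {A : Set} → ℕ → (ℕ → A) → (ℕ → A) → ℕ → A
glue n f g i with i <? n
... | yes _ = f i
... | no _ = g (i ∸ n)

glue-left : ∀ {A : Set} n (f g : ℕ → A) {i} → i < n → glue n f g i ≡ f i
glue-left n f g {i} i<n with i <? n
... | yes _ = refl
... | no i≮n = contradiction i<n i≮n

glue-right : ∀ {A : Set} n (f g : ℕ → A) k → glue n f g (n + k) ≡ g k
glue-right n f g k with n + k <? n
... | yes lt = contradiction (m≤m+n n k) (<⇒≱ lt)
... | no _ = cong g (m+n∸m≡n n k)

module _ {u₁ v₁ u₂ v₂ : List ℕ} (E₁ : Embedding u₁ v₁) (E₂ : Embedding u₂ v₂)
         (cross : ∀ {i j} → i < length u₁ → j < length u₂ →
                  ((u₁ ! i < u₂ ! j) ⇔ (v₁ ! index E₁ i < v₂ ! index E₂ j)) ×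
                  ((u₂ ! j < u₁ ! i) ⇔ (v₂ ! index E₂ j < v₁ ! index E₁ i))) where
  private
    n₁ : ℕ
    n₁ = length u₁

    e : ℕ → ℕ
    e = glue n₁ (index E₁) ((length v₁ +_) ∘ index E₂)

    split : ∀ {i} → i < length (u₁ ++ u₂) → SplitIndex n₁ (length u₂) i
    split {i} i<n = splitIndex n₁ (length u₂) i (subst (i <_) (length-++ u₁) i<n)

    e-left : ∀ {i} → i < n₁ → e i ≡ index E₁ i
    e-left = glue-left n₁ (index E₁) _

    e-right : ∀ k → e (n₁ + k) ≡ length v₁ + index E₂ k
    e-right = glue-right n₁ (index E₁) _

    v-left : ∀ {i} → i < n₁ → (v₁ ++ v₂) ! e i ≡ v₁ ! index E₁ i
    v-left i<n₁ rewrite e-left i<n₁ = !-++ˡ v₁ v₂ (in-range E₁ i<n₁)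

    v-right : ∀ k → (v₁ ++ v₂) ! e (n₁ + k) ≡ v₂ ! index E₂ k
    v-right k rewrite e-right k = !-++ʳ v₁ v₂ (index E₂ k)

    increasing′ : ∀ {i j} → i < j → j < length (u₁ ++ u₂) → e i < e j
    increasing′ {i} {j} i<j j<n with split (<-trans i<j j<n) | split j<n
    ... | left i<n₁ | left j<n₁ rewrite e-left i<n₁ | e-left j<n₁ = increasing E₁ i<j j<n₁
    ... | left i<n₁ | right k _ refl rewrite e-left i<n₁ | e-right k =
          <-≤-trans (in-range E₁ i<n₁) (m≤m+n (length v₁) _)
    ... | right k _ refl | left j<n₁ = contradiction (m≤m+n n₁ k) (<⇒≱ (<-trans i<j j<n₁))
    ... | right k _ refl | right k′ k′<n refl rewrite e-right k | e-right k′ =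
          +-monoʳ-< (length v₁) (increasing E₂ (+-cancelˡ-< n₁ k k′ i<j) k′<n)

    in-range′ : ∀ {i} → i < length (u₁ ++ u₂) → e i < length (v₁ ++ v₂)
    in-range′ i<n rewrite length-++ v₁ {v₂} with split i<n
    ... | left i<n₁ rewrite e-left i<n₁ = <-≤-trans (in-range E₁ i<n₁) (m≤m+n _ _)
    ... | right k k<n refl rewrite e-right k = +-monoʳ-< (length v₁) (in-range E₂ k<n)

    order′ : ∀ {i j} → i < length (u₁ ++ u₂) → j < length (u₁ ++ u₂) →
             ((u₁ ++ u₂) ! i < (u₁ ++ u₂) ! j) ⇔ ((v₁ ++ v₂) ! e i < (v₁ ++ v₂) ! e j)
    order′ {i} {j} i<n j<n with split i<n | split j<n
    ... | left i<n₁ | left j<n₁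
      rewrite !-++ˡ u₁ u₂ i<n₁ | !-++ˡ u₁ u₂ j<n₁ | v-left i<n₁ | v-left j<n₁ = order E₁ i<n₁ j<n₁
    ... | left i<n₁ | right k k<n refl
      rewrite !-++ˡ u₁ u₂ i<n₁ | !-++ʳ u₁ u₂ k | v-left i<n₁ | v-right k = proj₁ (cross i<n₁ k<n)
    ... | right k k<n refl | left j<n₁
      rewrite !-++ˡ u₁ u₂ j<n₁ | !-++ʳ u₁ u₂ k | v-left j<n₁ | v-right k = proj₂ (cross j<n₁ k<n)
    ... | right k k<n refl | right k′ k′<n refl
      rewrite !-++ʳ u₁ u₂ k | !-++ʳ u₁ u₂ k′ | v-right k | v-right k′ = order E₂ k<n k′<n

  embedding-++ : Embedding (u₁ ++ u₂) (v₁ ++ v₂)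
  embedding-++ = record { index = e ; increasing = increasing′ ; in-range = in-range′ ; order = order′ }

Below : List ℕ → List ℕ → Set
Below u v = ∀ {i j} → i < length u → j < length v → u ! i < v ! j

⇔-both-true : ∀ {A B : Set} → A → B → A ⇔ B
⇔-both-true a b = mk⇔ (λ _ → b) (λ _ → a)

⇔-both-false : ∀ {A B : Set} → ¬ A → ¬ B → A ⇔ B
⇔-both-false ¬a ¬b = mk⇔ (⊥-elim ∘ ¬a) (⊥-elim ∘ ¬b)

module _ {u₁ v₁ u₂ v₂ : List ℕ} (E₁ : Embedding u₁ v₁) (E₂ : Embedding u₂ v₂) where

  embedding-++-below : Below u₁ u₂ → Below v₁ v₂ → Embedding (u₁ ++ u₂) (v₁ ++ v₂)
  embedding-++-below u₁<u₂ v₁<v₂ = embedding-++ E₁ E₂ λ i<n j<n →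
    let u< = u₁<u₂ i<n j<n ; v< = v₁<v₂ (in-range E₁ i<n) (in-range E₂ j<n)
    in ⇔-both-true u< v< , ⇔-both-false (<-asym u<) (<-asym v<)

  embedding-++-above : Below u₂ u₁ → Below v₂ v₁ → Embedding (u₁ ++ u₂) (v₁ ++ v₂)
  embedding-++-above u₂<u₁ v₂<v₁ = embedding-++ E₁ E₂ λ i<n j<n →
    let u< = u₂<u₁ j<n i<n ; v< = v₂<v₁ (in-range E₂ j<n) (in-range E₁ i<n)
    in ⇔-both-false (<-asym u<) (<-asym v<) , ⇔-both-true u< v<

embedding-refl : ∀ u → Embedding u u
embedding-refl u = record { index = λ i → i ; increasing = λ i<j _ → i<j ; in-range = λ i<n → i<n
                          ; order = λ _ _ → mk⇔ (λ lt → lt) (λ lt → lt) }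

embedding-[] : ∀ v → Embedding [] v
embedding-[] v = record { index = λ i → i ; increasing = λ _ () ; in-range = λ () ; order = λ () }

embedding-shift : ∀ {u v} m n → Embedding u v → Embedding (map (m +_) u) (map (n +_) v)
embedding-shift {u} {v} m n E = record
  { index = index E
  ; increasing = λ i<j j<n → increasing E i<j (length-map-< u j<n)
  ; in-range = λ i<n → subst (index E _ <_) (sym (length-map _ v)) (in-range E (length-map-< u i<n))
  ; order = order′ }
  where
  order′ : ∀ {i j} → i < length (map (m +_) u) → j < length (map (m +_) u) →
           (map (m +_) u ! i < map (m +_) u ! j) ⇔ (map (n +_) v ! index E i < map (n +_) v ! index E j)
  order′ i<n j<n
    rewrite !-map (m +_) u (length-map-< u i<n) | !-map (m +_) u (length-map-< u j<n)
          | !-map (n +_) v (in-range E (length-map-< u i<n)) | !-map (n +_) v (in-range E (length-map-< u j<n))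
    = let o = order E (length-map-< u i<n) (length-map-< u j<n) in
      mk⇔ (+-monoʳ-< n ∘ to o ∘ +-cancelˡ-< m _ _)
          (+-monoʳ-< m ∘ from o ∘ +-cancelˡ-< n _ _)

wordOf-below-shift : ∀ x y {k} → size x ≤ k → Below (wordOf x) (map (k +_) (wordOf y))
wordOf-below-shift x y {k} x≤k {i} {j} i<n j<n rewrite !-map (k +_) (wordOf y) (length-map-< (wordOf y) j<n) =
  ≤-<-trans (≤-trans (proj₂ (wordOf-!-range x (in-size x i<n))) x≤k)
            (m<m+n k (proj₁ (wordOf-!-range y (in-size y (length-map-< (wordOf y) j<n)))))
  where
  in-size : ∀ t {i} → i < length (wordOf t) → i < size t
  in-size t {i} = subst (i <_) (length-wordOf t)

wordOf-below : ∀ x y → Below (wordOf x) (map (length (wordOf x) +_) (wordOf y))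
wordOf-below x y = wordOf-below-shift x y (≤-reflexive (sym (length-wordOf x)))

embedding-⊞ˡ : ∀ x′ x y → Embedding (wordOf x′) (wordOf x) → Embedding (wordOf (x′ ⊞ y)) (wordOf (x ⊞ y))
embedding-⊞ˡ x′ x y E =
  embedding-++-below E (embedding-shift _ _ (embedding-refl (wordOf y))) (wordOf-below x′ y) (wordOf-below x y)

embedding-⊞ʳ : ∀ x y′ y → Embedding (wordOf y′) (wordOf y) → Embedding (wordOf (x ⊞ y′)) (wordOf (x ⊞ y))
embedding-⊞ʳ x y′ y E =
  embedding-++-below (embedding-refl (wordOf x)) (embedding-shift _ _ E) (wordOf-below x y′) (wordOf-below x y)

embedding-⊟ˡ : ∀ x′ x y → Embedding (wordOf x′) (wordOf x) → Embedding (wordOf (x′ ⊟ y)) (wordOf (x ⊟ y))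
embedding-⊟ˡ x′ x y E =
  embedding-++-above (embedding-shift _ _ E) (embedding-refl (wordOf y)) (wordOf-below y x′) (wordOf-below y x)

embedding-⊟ʳ : ∀ x y′ y → Embedding (wordOf y′) (wordOf y) → Embedding (wordOf (x ⊟ y′)) (wordOf (x ⊟ y))
embedding-⊟ʳ x y′ y E =
  embedding-++-above (embedding-shift _ _ (embedding-refl (wordOf x))) E (wordOf-below y′ x) (wordOf-below y x)

Colour : Set
Colour = ℕ ⊎ ℕ

Allowed : List ℕ → List ℕ → Colour → Set
Allowed Is Ds (inj₁ d) = d ∈ Is
Allowed Is Ds (inj₂ d) = d ∈ Ds

Compatible : Rel ℕ 0ℓ → Rel ℕ 0ℓ → Colour → Colour → ℕ → ℕ → Set
Compatible R₁ R₂ (inj₁ d) (inj₁ d′) m n = d ≡ d′ → R₁ m n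
Compatible R₁ R₂ (inj₂ d) (inj₂ d′) m n = d ≡ d′ → R₂ m n
Compatible R₁ R₂ (inj₁ _) (inj₂ _) m n = ⊤
Compatible R₁ R₂ (inj₂ _) (inj₁ _) m n = ⊤

-- Covers is the case R₁ = _<_, R₂ = _>_; keeping the relations abstract lets swapColouring
-- exchange increasing and decreasing colours.
record Colouring (R₁ R₂ : Rel ℕ 0ℓ) (Is Ds u : List ℕ) : Set where
  field
    colour     : ℕ → Colour
    allowed    : ∀ {i} → i < length u → Allowed Is Ds (colour i)
    compatible : ∀ {i j} → i < j → j < length u → Compatible R₁ R₂ (colour i) (colour j) (u ! i) (u ! j)
open Colouring

Covers : ℕ → ℕ → List ℕ → Set
Covers r s = Colouring _<_ _>_ (upTo r) (upTo s)

compatible-map : ∀ {R₁ R₂ R₁′ R₂′ : Rel ℕ 0ℓ} {m n m′ n′} x y → (R₁ m n → R₁′ m′ n′) → (R₂ m n → R₂′ m′ n′) →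
                 Compatible R₁ R₂ x y m n → Compatible R₁′ R₂′ x y m′ n′
compatible-map (inj₁ _) (inj₁ _) f g c = f ∘ c
compatible-map (inj₂ _) (inj₂ _) f g c = g ∘ c
compatible-map (inj₁ _) (inj₂ _) f g c = tt
compatible-map (inj₂ _) (inj₁ _) f g c = tt

compatible-swap : ∀ {R₁ R₂ : Rel ℕ 0ℓ} {m n} x y → Compatible R₁ R₂ x y m n → Compatible R₂ R₁ (swap x) (swap y) m n
compatible-swap (inj₁ _) (inj₁ _) c = c
compatible-swap (inj₂ _) (inj₂ _) c = c
compatible-swap (inj₁ _) (inj₂ _) c = tt
compatible-swap (inj₂ _) (inj₁ _) c = tt

compatible-renameʳ : ∀ {R₁ R₂ : Rel ℕ 0ℓ} {m n} (f : ℕ → ℕ) → (∀ {d d′} → f d ≡ f d′ → d ≡ d′) → ∀ x y →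
                     Compatible R₁ R₂ x y m n → Compatible R₁ R₂ (map₂ f x) (map₂ f y) m n
compatible-renameʳ f f-inj (inj₁ _) (inj₁ _) c = c
compatible-renameʳ f f-inj (inj₂ _) (inj₂ _) c = c ∘ f-inj
compatible-renameʳ f f-inj (inj₁ _) (inj₂ _) c = tt
compatible-renameʳ f f-inj (inj₂ _) (inj₁ _) c = tt

swapColouring : ∀ {R₁ R₂ Is Ds u} → Colouring R₁ R₂ Is Ds u → Colouring R₂ R₁ Ds Is u
swapColouring κ = record
  { colour = swap ∘ colour κ
  ; allowed = λ i<n → allowed-swap (colour κ _) (allowed κ i<n)
  ; compatible = λ i<j j<n → compatible-swap (colour κ _) (colour κ _) (compatible κ i<j j<n) }
  where
  allowed-swap : ∀ {Is Ds} x → Allowed Is Ds x → Allowed Ds Is (swap x)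
  allowed-swap (inj₁ _) a = a
  allowed-swap (inj₂ _) a = a

weakenColouring : ∀ {R₁ R₂ Is Ds Is′ Ds′ u} → Is ⊆ Is′ → Ds ⊆ Ds′ → Colouring R₁ R₂ Is Ds u → Colouring R₁ R₂ Is′ Ds′ u
weakenColouring Is⊆ Ds⊆ κ = record
  { colour = colour κ
  ; allowed = λ i<n → allowed-weaken (colour κ _) (allowed κ i<n)
  ; compatible = compatible κ }
  where
  allowed-weaken : ∀ x → Allowed _ _ x → Allowed _ _ x
  allowed-weaken (inj₁ _) a = Is⊆ a
  allowed-weaken (inj₂ _) a = Ds⊆ a

upTo-⊆ : ∀ {m n} → m ≤ n → upTo m ⊆ upTo n
upTo-⊆ m≤n d∈ = ∈-upTo⁺ (<-≤-trans (∈-upTo⁻ d∈) m≤n)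

covers-mono : ∀ {r s r′ s′ u} → r ≤ r′ → s ≤ s′ → Covers r s u → Covers r′ s′ u
covers-mono r≤ s≤ = weakenColouring (upTo-⊆ r≤) (upTo-⊆ s≤)

module _ {Is Ds u : List ℕ} (k : ℕ) where

  colouring-unshift : Colouring _<_ _>_ Is Ds (map (k +_) u) → Colouring _<_ _>_ Is Ds u
  colouring-unshift κ = record
    { colour = colour κ
    ; allowed = λ i<n → allowed κ (shifted i<n)
    ; compatible = λ {i} {j} i<j j<n → compatible-map (colour κ i) (colour κ j) (+-cancelˡ-< k _ _) (+-cancelˡ-< k _ _)
        (subst₂ (Compatible _<_ _>_ (colour κ i) (colour κ j)) (!-map (k +_) u (<-trans i<j j<n)) (!-map (k +_) u j<n)
          (compatible κ i<j (shifted j<n))) }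
    where
    shifted : ∀ {i} → i < length u → i < length (map (k +_) u)
    shifted {i} = subst (i <_) (sym (length-map _ u))

  colouring-shift : Colouring _<_ _>_ Is Ds u → Colouring _<_ _>_ Is Ds (map (k +_) u)
  colouring-shift κ = record
    { colour = colour κ
    ; allowed = λ i<n → allowed κ (length-map-< u i<n)
    ; compatible = λ {i} {j} i<j j<n →
        subst₂ (Compatible _<_ _>_ (colour κ i) (colour κ j))
          (sym (!-map (k +_) u (<-trans i<j (length-map-< u j<n)))) (sym (!-map (k +_) u (length-map-< u j<n)))
          (compatible-map (colour κ i) (colour κ j) (+-monoʳ-< k) (+-monoʳ-< k) (compatible κ i<j (length-map-< u j<n))) }

compatible-same₁ : ∀ {R₁ R₂ : Rel ℕ 0ℓ} {x y m n d} → Compatible R₁ R₂ x y m n → x ≡ inj₁ d → y ≡ inj₁ d → R₁ m n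
compatible-same₁ c refl refl = c refl

compatible-same₂ : ∀ {R₁ R₂ : Rel ℕ 0ℓ} {x y m n d} → Compatible R₁ R₂ x y m n → x ≡ inj₂ d → y ≡ inj₂ d → R₂ m n
compatible-same₂ c refl refl = c refl

length-filter-∁ : ∀ {P : ℕ → Set} (P? : Decidable P) xs →
                  length (filter P? xs) + length (filter (¬? ∘ P?) xs) ≡ length xs
length-filter-∁ P? [] = refl
length-filter-∁ P? (x ∷ xs) with P? x
... | yes _ = cong suc (length-filter-∁ P? xs)
... | no _ = trans (+-suc _ _) (cong suc (length-filter-∁ P? xs))

++-<ˡ : ∀ (X Y : List ℕ) {i} → i < length X → i < length (X ++ Y)
++-<ˡ X Y i<n = <-≤-trans i<n (subst (length X ≤_) (sym (length-++ X)) (m≤m+n _ _))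

++-<ʳ : ∀ (X Y : List ℕ) {j} → j < length Y → length X + j < length (X ++ Y)
++-<ʳ X Y {j} j<n = subst (length X + j <_) (sym (length-++ X)) (+-monoʳ-< (length X) j<n)

-- The decreasing colours used on X and on Y are disjoint, because no R₂-relation goes from X to Y.
module _ {R₁ R₂ : Rel ℕ 0ℓ} {Is Ds : List ℕ} (X Y : List ℕ) (κ : Colouring R₁ R₂ Is Ds (X ++ Y))
         (no-R₂ : ∀ {i j} → i < length X → j < length Y → ¬ R₂ (X ! i) (Y ! j)) where
  private
    UsedOnX : ℕ → Set
    UsedOnX d = ∃ λ (k : Fin (length X)) → colour κ (toℕ k) ≡ inj₂ d

    usedOnX? : Decidable UsedOnX
    usedOnX? d = any? (λ k → ≡-dec _≟_ _≟_ (colour κ (toℕ k)) (inj₂ d))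

    allowed-filter : ∀ {Q : ℕ → Set} (Q? : Decidable Q) x → Allowed Is Ds x →
                     (∀ d → x ≡ inj₂ d → Q d) → Allowed Is (filter Q? Ds) x
    allowed-filter Q? (inj₁ _) a _ = a
    allowed-filter Q? (inj₂ d) a q = ∈-filter⁺ Q? a (q d refl)

    colouringX : Colouring R₁ R₂ Is (filter usedOnX? Ds) X
    colouringX = record
      { colour = colour κ
      ; allowed = λ i<n → allowed-filter usedOnX? _ (allowed κ (++-<ˡ X Y i<n))
                    (λ d eq → fromℕ< i<n , trans (cong (colour κ) (toℕ-fromℕ< i<n)) eq)
      ; compatible = λ {i} {j} i<j j<n → subst₂ (Compatible R₁ R₂ (colour κ i) (colour κ j))
                       (!-++ˡ X Y (<-trans i<j j<n)) (!-++ˡ X Y j<n) (compatible κ i<j (++-<ˡ X Y j<n)) }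

    unusedOnX : ∀ {j} → j < length Y → ∀ d → colour κ (length X + j) ≡ inj₂ d → ¬ UsedOnX d
    unusedOnX {j} j<n d eqY (k , eqX) = no-R₂ (toℕ<n k) j<n
      (subst₂ R₂ (!-++ˡ X Y (toℕ<n k)) (!-++ʳ X Y j)
        (compatible-same₂ (compatible κ (<-≤-trans (toℕ<n k) (m≤m+n _ j)) (++-<ʳ X Y j<n)) eqX eqY))

    colouringY : Colouring R₁ R₂ Is (filter (¬? ∘ usedOnX?) Ds) Y
    colouringY = record
      { colour = colour κ ∘ (length X +_)
      ; allowed = λ j<n → allowed-filter (¬? ∘ usedOnX?) _ (allowed κ (++-<ʳ X Y j<n)) (unusedOnX j<n)
      ; compatible = λ {i} {j} i<j j<n →
          subst₂ (Compatible R₁ R₂ (colour κ (length X + i)) (colour κ (length X + j))) (!-++ʳ X Y i) (!-++ʳ X Y j)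
            (compatible κ (+-monoʳ-< (length X) i<j) (++-<ʳ X Y j<n)) }

  splitColouring : ∃ λ DX → ∃ λ DY → length DX + length DY ≡ length Ds ×
                   Colouring R₁ R₂ Is DX X × Colouring R₁ R₂ Is DY Y
  splitColouring = _ , _ , length-filter-∁ usedOnX? Ds , colouringX , colouringY

module _ {R₁ R₂ : Rel ℕ 0ℓ} {Is : List ℕ} {m n : ℕ} (X Y : List ℕ)
         (CX : Colouring R₁ R₂ Is (upTo m) X) (CY : Colouring R₁ R₂ Is (upTo n) Y)
         (R₁-across : ∀ {i j} → i < length X → j < length Y → R₁ (X ! i) (Y ! j)) where
  private
    colourY : ℕ → Colour
    colourY = map₂ (m +_) ∘ colour CY

    c : ℕ → Colour
    c = glue (length X) (colour CX) colourY

    split : ∀ {i} → i < length (X ++ Y) → SplitIndex (length X) (length Y) i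
    split {i} i<n = splitIndex (length X) (length Y) i (subst (i <_) (length-++ X) i<n)

    allowedX : ∀ x → Allowed Is (upTo m) x → Allowed Is (upTo (m + n)) x
    allowedX (inj₁ _) a = a
    allowedX (inj₂ _) a = upTo-⊆ (m≤m+n m n) a

    allowedY : ∀ x → Allowed Is (upTo n) x → Allowed Is (upTo (m + n)) (map₂ (m +_) x)
    allowedY (inj₁ _) a = a
    allowedY (inj₂ _) a = ∈-upTo⁺ (+-monoʳ-< m (∈-upTo⁻ a))

    compatible-across : ∀ {a b} → R₁ a b → ∀ x y → Allowed Is (upTo m) x → Compatible R₁ R₂ x (map₂ (m +_) y) a b
    compatible-across r (inj₁ _) (inj₁ _) _ _ = r
    compatible-across r (inj₂ d) (inj₂ d′) a eq = contradiction (subst (m ≤_) (sym eq) (m≤m+n m d′)) (<⇒≱ (∈-upTo⁻ a))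
    compatible-across r (inj₁ _) (inj₂ _) _ = tt
    compatible-across r (inj₂ _) (inj₁ _) _ = tt

    allowed′ : ∀ {i} → i < length (X ++ Y) → Allowed Is (upTo (m + n)) (c i)
    allowed′ i<n with split i<n
    ... | left i<m rewrite glue-left (length X) (colour CX) colourY i<m = allowedX (colour CX _) (allowed CX i<m)
    ... | right k k<n refl rewrite glue-right (length X) (colour CX) colourY k = allowedY (colour CY k) (allowed CY k<n)

    compatible′ : ∀ {i j} → i < j → j < length (X ++ Y) → Compatible R₁ R₂ (c i) (c j) ((X ++ Y) ! i) ((X ++ Y) ! j)
    compatible′ {i} {j} i<j j<n with split (<-trans i<j j<n) | split j<n
    ... | left i<m | left j<m
      rewrite glue-left (length X) (colour CX) colourY i<m | glue-left (length X) (colour CX) colourY j<m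
            | !-++ˡ X Y i<m | !-++ˡ X Y j<m = compatible CX i<j j<m
    ... | left i<m | right k k<n refl
      rewrite glue-left (length X) (colour CX) colourY i<m | glue-right (length X) (colour CX) colourY k
            | !-++ˡ X Y i<m | !-++ʳ X Y k = compatible-across (R₁-across i<m k<n) (colour CX i) (colour CY k) (allowed CX i<m)
    ... | right k _ refl | left j<m = contradiction (m≤m+n (length X) k) (<⇒≱ (<-trans i<j j<m))
    ... | right k _ refl | right k′ k′<n refl
      rewrite glue-right (length X) (colour CX) colourY k | glue-right (length X) (colour CX) colourY k′
            | !-++ʳ X Y k | !-++ʳ X Y k′ =
      compatible-renameʳ (m +_) (+-cancelˡ-≡ m _ _) (colour CY k) (colour CY k′) (compatible CY (+-cancelˡ-< (length X) k k′ i<j) k′<n)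

  joinColouring : Colouring R₁ R₂ Is (upTo (m + n)) (X ++ Y)
  joinColouring = record { colour = c ; allowed = allowed′ ; compatible = compatible′ }

π-at-fromℕ< : ∀ π {i} (i<n : i < len π) → π at fromℕ< i<n ≡ word π ! i
π-at-fromℕ< π i<n = trans (lookup≡! (word π) (fromℕ< i<n)) (cong (word π !_) (toℕ-fromℕ< i<n))

module _ {r s : ℕ} where

  toColour : Fin r ⊎ Fin s → Colour
  toColour = Sum.map toℕ toℕ

  fromColour : ∀ x → Allowed (upTo r) (upTo s) x → Fin r ⊎ Fin s
  fromColour (inj₁ d) a = inj₁ (fromℕ< (∈-upTo⁻ a))
  fromColour (inj₂ d) a = inj₂ (fromℕ< (∈-upTo⁻ a))

  allowed-toColour : ∀ x → Allowed (upTo r) (upTo s) (toColour x)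
  allowed-toColour (inj₁ a) = ∈-upTo⁺ (toℕ<n a)
  allowed-toColour (inj₂ b) = ∈-upTo⁺ (toℕ<n b)

  compatible-toColour : ∀ {m n} x y → (∀ a → x ≡ inj₁ a → y ≡ inj₁ a → m < n) → (∀ b → x ≡ inj₂ b → y ≡ inj₂ b → m > n) →
                        Compatible _<_ _>_ (toColour x) (toColour y) m n
  compatible-toColour (inj₁ a) (inj₁ a′) inc dec eq = inc a refl (cong inj₁ (sym (toℕ-injective eq)))
  compatible-toColour (inj₂ b) (inj₂ b′) inc dec eq = dec b refl (cong inj₂ (sym (toℕ-injective eq)))
  compatible-toColour (inj₁ _) (inj₂ _) inc dec = tt
  compatible-toColour (inj₂ _) (inj₁ _) inc dec = tt

  fromColour-inj₁ : ∀ x a (c : Fin r) → fromColour x a ≡ inj₁ c → x ≡ inj₁ (toℕ c)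
  fromColour-inj₁ (inj₁ d) a c refl = cong inj₁ (sym (toℕ-fromℕ< _))

  fromColour-inj₂ : ∀ x a (c : Fin s) → fromColour x a ≡ inj₂ c → x ≡ inj₂ (toℕ c)
  fromColour-inj₂ (inj₂ d) a c refl = cong inj₂ (sym (toℕ-fromℕ< _))

  extendColouring : ∀ n → (∀ {i} → i < n → Fin r ⊎ Fin s) → ℕ → Colour
  extendColouring n c i with i <? n
  ... | yes i<n = toColour (c i<n)
  ... | no _ = inj₁ 0

  extendColouring-< : ∀ n (c : ∀ {i} → i < n → Fin r ⊎ Fin s) {i} (i<n : i < n) → extendColouring n c i ≡ toColour (c i<n)
  extendColouring-< n c {i} i<n with i <? n
  ... | yes i<n′ = cong (λ p → toColour (c p)) (<-irrelevant i<n′ i<n)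
  ... | no i≮n = contradiction i<n i≮n

  coverable⇒covers : ∀ π → Coverable r s π → Covers r s (word π)
  coverable⇒covers π (c , chains) = record
    { colour = extendColouring (len π) c′
    ; allowed = λ i<n → subst (Allowed (upTo r) (upTo s)) (sym (extendColouring-< (len π) c′ i<n)) (allowed-toColour (c′ i<n))
    ; compatible = compatible′ }
    where
    c′ : ∀ {i} → i < len π → Fin r ⊎ Fin s
    c′ i<n = c (fromℕ< i<n)
    compatible′ : ∀ {i j} → i < j → j < len π →
                  Compatible _<_ _>_ (extendColouring (len π) c′ i) (extendColouring (len π) c′ j) (word π ! i) (word π ! j)
    compatible′ i<j j<n
      rewrite extendColouring-< (len π) c′ (<-trans i<j j<n) | extendColouring-< (len π) c′ j<n
            | sym (π-at-fromℕ< π (<-trans i<j j<n)) | sym (π-at-fromℕ< π j<n) =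
      let i<j′ = subst₂ _<_ (sym (toℕ-fromℕ< _)) (sym (toℕ-fromℕ< _)) i<j
      in compatible-toColour (c′ (<-trans i<j j<n)) (c′ j<n) (proj₁ (chains _ _ i<j′)) (proj₂ (chains _ _ i<j′))

  covers⇒coverable : ∀ π → Covers r s (word π) → Coverable r s π
  covers⇒coverable π κ = c , chains
    where
    c : Fin (len π) → Fin r ⊎ Fin s
    c i = fromColour (colour κ (toℕ i)) (allowed κ (toℕ<n i))
    chains : ∀ i j → i Fin.< j →
             (∀ a → c i ≡ inj₁ a → c j ≡ inj₁ a → π at i < π at j) × (∀ b → c i ≡ inj₂ b → c j ≡ inj₂ b → π at i > π at j)
    chains i j i<j rewrite lookup≡! (word π) i | lookup≡! (word π) j =
      (λ a ci cj → compatible-same₁ (compatible κ i<j (toℕ<n j)) (fromColour-inj₁ _ _ a ci) (fromColour-inj₁ _ _ a cj)) ,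
      (λ b ci cj → compatible-same₂ (compatible κ i<j (toℕ<n j)) (fromColour-inj₂ _ _ b ci) (fromColour-inj₂ _ _ b cj))

coverable-mono : ∀ π {r s r′ s′} → r ≤ r′ → s ≤ s′ → Coverable r s π → Coverable r′ s′ π
coverable-mono π r≤ s≤ = covers⇒coverable π ∘ covers-mono r≤ s≤ ∘ coverable⇒covers π

NonIncreasing : (ℕ → ℕ) → Set
NonIncreasing f = ∀ k → f (suc k) ≤ f k

VanishesFrom : (ℕ → ℕ) → ℕ → Set
VanishesFrom f N = ∀ k → N ≤ k → f k ≡ 0

-- f and g are the column and row lengths of one Young diagram {(r , s) ∣ s < f r}.
Conjugate : (ℕ → ℕ) → (ℕ → ℕ) → Set
Conjugate f g = ∀ r s → (s < f r) ⇔ (r < g s)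

nonIncreasing-≤ : ∀ {f} → NonIncreasing f → ∀ {k k′} → k ≤ k′ → f k′ ≤ f k
nonIncreasing-≤ f↓ {k} {k′} k≤k′ with m≤n⇒m<n∨m≡n k≤k′
... | inj₂ refl = ≤-refl
nonIncreasing-≤ f↓ {k} {suc k′} _ | inj₁ (s≤s k≤k′) = ≤-trans (f↓ k′) (nonIncreasing-≤ f↓ k≤k′)

nonIncreasing-+ : ∀ {f g} → NonIncreasing f → NonIncreasing g → NonIncreasing (λ k → f k + g k)
nonIncreasing-+ f↓ g↓ k = +-mono-≤ (f↓ k) (g↓ k)

vanishesFrom-+ : ∀ {f g M N} → VanishesFrom f M → VanishesFrom g N → VanishesFrom (λ k → f k + g k) (M + N)
vanishesFrom-+ {M = M} {N} f0 g0 k M+N≤k =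
  cong₂ _+_ (f0 k (≤-trans (m≤m+n M N) M+N≤k)) (g0 k (≤-trans (m≤n+m N M) M+N≤k))

vanishesFrom-mono : ∀ {f M N} → VanishesFrom f M → M ≤ N → VanishesFrom f N
vanishesFrom-mono f0 M≤N k N≤k = f0 k (≤-trans M≤N N≤k)

-- The number of initial columns of height > s, looking at the first N columns only.
transpose : ℕ → (ℕ → ℕ) → ℕ → ℕ
transpose zero f s = 0
transpose (suc N) f s with s <? f 0
... | yes _ = suc (transpose N (f ∘ suc) s)
... | no _ = 0

transpose-≤ : ∀ N f s → transpose N f s ≤ N
transpose-≤ zero f s = z≤n
transpose-≤ (suc N) f s with s <? f 0
... | yes _ = s≤s (transpose-≤ N (f ∘ suc) s)
... | no _ = z≤n

<-transpose : ∀ N f s → NonIncreasing f → ∀ r → (r < transpose N f s) ⇔ (r < N × s < f r)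
<-transpose zero f s f↓ r = mk⇔ (λ ()) (λ ())
<-transpose (suc N) f s f↓ r with s <? f 0
<-transpose (suc N) f s f↓ zero | yes s<f0 = mk⇔ (λ _ → s≤s z≤n , s<f0) (λ _ → s≤s z≤n)
<-transpose (suc N) f s f↓ (suc r) | yes _ = mk⇔
  (λ { (s≤s r<t) → Product.map₁ s≤s (to ih r<t) })
  (λ { (s≤s r<N , s<f) → s≤s (from ih (r<N , s<f)) })
  where ih = <-transpose N (f ∘ suc) s (f↓ ∘ suc) r
... | no s≮f0 = mk⇔ (λ ()) (λ (_ , s<f) → contradiction (<-≤-trans s<f (nonIncreasing-≤ f↓ z≤n)) s≮f0)

transpose-conjugate : ∀ N f → NonIncreasing f → VanishesFrom f N → Conjugate f (transpose N f)
transpose-conjugate N f f↓ f0 r s = mk⇔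
  (λ s<f → from (<-transpose N f s f↓ r) (r<N s<f , s<f))
  (proj₂ ∘ to (<-transpose N f s f↓ r))
  where
  r<N : s < f r → r < N
  r<N s<f with r <? N
  ... | yes r<N = r<N
  ... | no r≮N = contradiction (subst (s <_) (f0 r (≮⇒≥ r≮N)) s<f) n≮0

conjugate-sym : ∀ {f g} → Conjugate f g → Conjugate g f
conjugate-sym fg r s = ⇔-sym (fg s r)

conjugate⇒nonIncreasing : ∀ {f g} → Conjugate f g → NonIncreasing f
conjugate⇒nonIncreasing {f} fg k with f k <? f (suc k)
... | no fk≮ = ≮⇒≥ fk≮
... | yes fk< = contradiction (from (fg k (f k)) (<-trans (n<1+n k) (to (fg (suc k) (f k)) fk<))) (<-irrefl refl)

conjugate⇒vanishesFrom : ∀ {f g N} → Conjugate f g → (∀ s → g s ≤ N) → VanishesFrom f N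
conjugate⇒vanishesFrom {f} {g} fg g≤N r N≤r =
  n≤0⇒n≡0 (≮⇒≥ λ 0<fr → <⇒≱ (<-≤-trans (to (fg r 0) 0<fr) (g≤N 0)) N≤r)

conjugate-≤ : ∀ {f g} → Conjugate f g → ∀ r s → (f r ≤ s) ⇔ (g s ≤ r)
conjugate-≤ fg r s = mk⇔ (λ fr≤s → ≮⇒≥ λ r<gs → <⇒≱ (from (fg r s) r<gs) fr≤s)
                         (λ gs≤r → ≮⇒≥ λ s<fr → <⇒≱ (to (fg r s) s<fr) gs≤r)

-- An increasing sequence can run through both summands of a direct sum but a decreasing one
-- cannot, so over ⊞ the numbers of decreasing sequences needed add up; dually over ⊟.  The
-- other profile is in each case the conjugate one.
minDec minInc : Tree → ℕ → ℕ
minDec empty _ = 0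
minDec single zero = 1
minDec single (suc _) = 0
minDec (x ⊞ y) r = minDec x r + minDec y r
minDec (x ⊟ y) r = transpose (size x + size y) (λ s → minInc x s + minInc y s) r
minInc empty _ = 0
minInc single zero = 1
minInc single (suc _) = 0
minInc (x ⊞ y) s = transpose (size x + size y) (λ r → minDec x r + minDec y r) s
minInc (x ⊟ y) s = minInc x s + minInc y s

minDec-≤-size : ∀ t r → minDec t r ≤ size t
minInc-≤-size : ∀ t s → minInc t s ≤ size t
minDec-≤-size empty r = z≤n
minDec-≤-size single zero = ≤-refl
minDec-≤-size single (suc r) = z≤n
minDec-≤-size (x ⊞ y) r = +-mono-≤ (minDec-≤-size x r) (minDec-≤-size y r)
minDec-≤-size (x ⊟ y) r = transpose-≤ _ _ r
minInc-≤-size empty s = z≤n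
minInc-≤-size single zero = ≤-refl
minInc-≤-size single (suc s) = z≤n
minInc-≤-size (x ⊞ y) s = transpose-≤ _ _ s
minInc-≤-size (x ⊟ y) s = +-mono-≤ (minInc-≤-size x s) (minInc-≤-size y s)

minDec-conjugate : ∀ t → Conjugate (minDec t) (minInc t)
minDec-nonIncreasing : ∀ t → NonIncreasing (minDec t)
minInc-nonIncreasing : ∀ t → NonIncreasing (minInc t)
minDec-vanishesFrom : ∀ t → VanishesFrom (minDec t) (size t)
minInc-vanishesFrom : ∀ t → VanishesFrom (minInc t) (size t)

minDec-conjugate empty r s = mk⇔ (λ ()) (λ ())
minDec-conjugate single zero zero = mk⇔ (λ _ → s≤s z≤n) (λ _ → s≤s z≤n)
minDec-conjugate single zero (suc s) = mk⇔ (λ { (s≤s ()) }) (λ ())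
minDec-conjugate single (suc r) zero = mk⇔ (λ ()) (λ { (s≤s ()) })
minDec-conjugate single (suc r) (suc s) = mk⇔ (λ ()) (λ ())
minDec-conjugate (x ⊞ y) = transpose-conjugate (size x + size y) (λ r → minDec x r + minDec y r)
  (nonIncreasing-+ (minDec-nonIncreasing x) (minDec-nonIncreasing y))
  (vanishesFrom-+ (minDec-vanishesFrom x) (minDec-vanishesFrom y))
minDec-conjugate (x ⊟ y) = conjugate-sym (transpose-conjugate (size x + size y) (λ s → minInc x s + minInc y s)
  (nonIncreasing-+ (minInc-nonIncreasing x) (minInc-nonIncreasing y))
  (vanishesFrom-+ (minInc-vanishesFrom x) (minInc-vanishesFrom y)))

minDec-nonIncreasing t = conjugate⇒nonIncreasing (minDec-conjugate t)

minInc-nonIncreasing t = conjugate⇒nonIncreasing (conjugate-sym (minDec-conjugate t))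

minDec-vanishesFrom t = conjugate⇒vanishesFrom (minDec-conjugate t) (minInc-≤-size t)

minInc-vanishesFrom t = conjugate⇒vanishesFrom (conjugate-sym (minDec-conjugate t)) (minDec-≤-size t)

colouring⇒minDec-≤ : ∀ t {Is Ds} → Colouring _<_ _>_ Is Ds (wordOf t) → minDec t (length Is) ≤ length Ds
colouring⇒minInc-≤ : ∀ t {Is Ds} → Colouring _<_ _>_ Is Ds (wordOf t) → minInc t (length Ds) ≤ length Is

colouring⇒minInc-≤ t κ = to (conjugate-≤ (minDec-conjugate t) _ _) (colouring⇒minDec-≤ t κ)

colouring⇒minDec-≤ empty κ = z≤n
colouring⇒minDec-≤ single {_ ∷ _} κ = z≤n
colouring⇒minDec-≤ single {[]} κ = decreasing-colour (colour κ 0) (allowed κ (s≤s z≤n))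
  where
  decreasing-colour : ∀ {Ds} x → Allowed [] Ds x → 1 ≤ length Ds
  decreasing-colour (inj₂ _) d∈ = ∈-length d∈
colouring⇒minDec-≤ (x ⊞ y) κ
  with splitColouring (wordOf x) (map _ (wordOf y)) κ (λ i<n j<n → <-asym (wordOf-below x y i<n j<n))
... | _ , _ , |DX|+|DY|≡|Ds| , CX , CY =
  ≤-trans (+-mono-≤ (colouring⇒minDec-≤ x CX) (colouring⇒minDec-≤ y (colouring-unshift _ CY)))
          (≤-reflexive |DX|+|DY|≡|Ds|)
colouring⇒minDec-≤ (x ⊟ y) κ
  with splitColouring (map _ (wordOf x)) (wordOf y) (swapColouring κ) (λ i<n j<n → <-asym (wordOf-below y x j<n i<n))
... | _ , _ , |IX|+|IY|≡|Is| , CX , CY =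
  from (conjugate-≤ (minDec-conjugate (x ⊟ y)) _ _)
    (≤-trans (+-mono-≤ (colouring⇒minInc-≤ x (colouring-unshift _ (swapColouring CX)))
                       (colouring⇒minInc-≤ y (swapColouring CY)))
             (≤-reflexive |IX|+|IY|≡|Is|))

minDec-≤⇒covers : ∀ t {r s} → minDec t r ≤ s → Covers r s (wordOf t)
minInc-≤⇒covers : ∀ t {r s} → minInc t s ≤ r → Covers r s (wordOf t)

minInc-≤⇒covers t le = minDec-≤⇒covers t (from (conjugate-≤ (minDec-conjugate t) _ _) le)

minDec-≤⇒covers empty _ = record { colour = λ _ → inj₁ 0 ; allowed = λ () ; compatible = λ _ () }
minDec-≤⇒covers single {zero} 1≤s =
  record { colour = λ _ → inj₂ 0 ; allowed = λ _ → ∈-upTo⁺ 1≤s ; compatible = λ { {j = zero} () ; {j = suc _} _ (s≤s ()) } }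
minDec-≤⇒covers single {suc r} _ =
  record { colour = λ _ → inj₁ 0 ; allowed = λ _ → ∈-upTo⁺ (s≤s z≤n) ; compatible = λ { {j = zero} () ; {j = suc _} _ (s≤s ()) } }
minDec-≤⇒covers (x ⊞ y) le = covers-mono ≤-refl le
  (joinColouring (wordOf x) (map _ (wordOf y))
    (minDec-≤⇒covers x ≤-refl) (colouring-shift _ (minDec-≤⇒covers y ≤-refl)) (wordOf-below x y))
minDec-≤⇒covers (x ⊟ y) le = covers-mono (to (conjugate-≤ (minDec-conjugate (x ⊟ y)) _ _) le) ≤-refl
  (swapColouring (joinColouring (map _ (wordOf x)) (wordOf y)
    (swapColouring (colouring-shift _ (minInc-≤⇒covers x ≤-refl))) (swapColouring (minInc-≤⇒covers y ≤-refl))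
    (λ i<n j<n → wordOf-below y x j<n i<n)))

coverable⇔minDec-≤ : ∀ π t → wordOf t ≡ word π → ∀ r s → Coverable r s π ⇔ (minDec t r ≤ s)
coverable⇔minDec-≤ π t refl r s = mk⇔
  (λ κ → subst₂ _≤_ (cong (minDec t) (length-upTo r)) (length-upTo s) (colouring⇒minDec-≤ t (coverable⇒covers π κ)))
  (covers⇒coverable π ∘ minDec-≤⇒covers t)

stackˢ : (ℕ → ℕ) → ℕ × ℕ → ℕ × ℕ
stackˢ f (r , s) = r , f r + s

stackʳ : (ℕ → ℕ) → ℕ × ℕ → ℕ × ℕ
stackʳ g (r , s) = g s + r , s

-- Listed so that its length is visibly size t: the diagram of y is stacked above (⊞) or
-- beside (⊟) that of x.
diagram : Tree → List (ℕ × ℕ)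
diagram empty = []
diagram single = [ (0 , 0) ]
diagram (x ⊞ y) = diagram x ++ map (stackˢ (minDec x)) (diagram y)
diagram (x ⊟ y) = diagram x ++ map (stackʳ (minInc x)) (diagram y)

length-diagram : ∀ t → length (diagram t) ≡ size t
length-diagram empty = refl
length-diagram single = refl
length-diagram (x ⊞ y) = trans (length-++ (diagram x))
  (cong₂ _+_ (length-diagram x) (trans (length-map _ (diagram y)) (length-diagram y)))
length-diagram (x ⊟ y) = trans (length-++ (diagram x))
  (cong₂ _+_ (length-diagram x) (trans (length-map _ (diagram y)) (length-diagram y)))

∈-diagram : ∀ t r s → (r , s) ∈ diagram t ⇔ (s < minDec t r)
∈-diagram empty r s = mk⇔ (λ ()) (λ ())
∈-diagram single zero zero = mk⇔ (λ _ → s≤s z≤n) (λ _ → here refl)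
∈-diagram single zero (suc s) = mk⇔ (λ { (here ()) ; (there ()) }) (λ { (s≤s ()) })
∈-diagram single (suc r) s = mk⇔ (λ { (here ()) ; (there ()) }) (λ ())
∈-diagram (x ⊞ y) r s = mk⇔ to′ from′
  where
  to′ : (r , s) ∈ diagram (x ⊞ y) → s < minDec x r + minDec y r
  to′ ∈xy with ∈-++⁻ (diagram x) ∈xy
  ... | inj₁ ∈x = <-≤-trans (to (∈-diagram x r s) ∈x) (m≤m+n _ _)
  ... | inj₂ ∈y with ∈-map⁻ (stackˢ (minDec x)) ∈y
  ... | (r′ , s′) , ∈y′ , refl = +-monoʳ-< (minDec x r′) (to (∈-diagram y r′ s′) ∈y′)
  from′ : s < minDec x r + minDec y r → (r , s) ∈ diagram (x ⊞ y)
  from′ s< with splitIndex (minDec x r) (minDec y r) s s<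
  ... | left s<x = ∈-++⁺ˡ (from (∈-diagram x r s) s<x)
  ... | right l l<y refl = ∈-++⁺ʳ (diagram x) (∈-map⁺ (stackˢ (minDec x)) (from (∈-diagram y r l) l<y))
∈-diagram (x ⊟ y) r s = ⇔-trans (mk⇔ to′ from′) (⇔-sym (minDec-conjugate (x ⊟ y) r s))
  where
  to′ : (r , s) ∈ diagram (x ⊟ y) → r < minInc x s + minInc y s
  to′ ∈xy with ∈-++⁻ (diagram x) ∈xy
  ... | inj₁ ∈x = <-≤-trans (to (minDec-conjugate x r s) (to (∈-diagram x r s) ∈x)) (m≤m+n _ _)
  ... | inj₂ ∈y with ∈-map⁻ (stackʳ (minInc x)) ∈y
  ... | (r′ , s′) , ∈y′ , refl = +-monoʳ-< (minInc x s′) (to (minDec-conjugate y r′ s′) (to (∈-diagram y r′ s′) ∈y′))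
  from′ : r < minInc x s + minInc y s → (r , s) ∈ diagram (x ⊟ y)
  from′ r< with splitIndex (minInc x s) (minInc y s) r r<
  ... | left r<x = ∈-++⁺ˡ (from (∈-diagram x r s) (from (minDec-conjugate x r s) r<x))
  ... | right l l<y refl =
    ∈-++⁺ʳ (diagram x) (∈-map⁺ (stackʳ (minInc x)) (from (∈-diagram y l s) (from (minDec-conjugate y l s) l<y)))

unique-diagram : ∀ t → Unique (diagram t)
unique-diagram empty = []
unique-diagram single = [] ∷ []
unique-diagram (x ⊞ y) = Unique.++⁺ (unique-diagram x) (Unique.map⁺ stack-injective (unique-diagram y)) disjoint
  where
  stack-injective : ∀ {p q} → stackˢ (minDec x) p ≡ stackˢ (minDec x) q → p ≡ q
  stack-injective {r , s} {r′ , s′} eq with cong proj₁ eq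
  ... | refl = cong (r ,_) (+-cancelˡ-≡ (minDec x r) s s′ (cong proj₂ eq))
  disjoint : ∀ {v} → ¬ (v ∈ diagram x × v ∈ map (stackˢ (minDec x)) (diagram y))
  disjoint {r , s} (∈x , ∈y) with ∈-map⁻ (stackˢ (minDec x)) ∈y
  ... | _ , _ , refl = <⇒≱ (to (∈-diagram x r s) ∈x) (m≤m+n _ _)
unique-diagram (x ⊟ y) = Unique.++⁺ (unique-diagram x) (Unique.map⁺ stack-injective (unique-diagram y)) disjoint
  where
  stack-injective : ∀ {p q} → stackʳ (minInc x) p ≡ stackʳ (minInc x) q → p ≡ q
  stack-injective {r , s} {r′ , s′} eq with cong proj₂ eq
  ... | refl = cong (_, s) (+-cancelˡ-≡ (minInc x s) r r′ (cong proj₁ eq))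
  disjoint : ∀ {v} → ¬ (v ∈ diagram x × v ∈ map (stackʳ (minInc x)) (diagram y))
  disjoint {r , s} (∈x , ∈y) with ∈-map⁻ (stackʳ (minInc x)) ∈y
  ... | _ , _ , refl = <⇒≱ (to (minDec-conjugate x r s) (to (∈-diagram x r s) ∈x)) (m≤m+n _ _)

unique-⊆⇒length-≤ : ∀ {A : Set} {xs ys : List A} → Unique xs → xs ⊆ ys → length xs ≤ length ys
unique-⊆⇒length-≤ {xs = []} _ _ = z≤n
unique-⊆⇒length-≤ {xs = x ∷ xs} {ys} (x∉xs ∷ u) xs⊆ys with ∈-∃++ (xs⊆ys (here refl))
... | ys₁ , ys₂ , refl = begin
  suc (length xs)                    ≤⟨ s≤s (unique-⊆⇒length-≤ u xs⊆ys₁ys₂) ⟩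
  suc (length (ys₁ ++ ys₂))          ≡⟨ cong suc (length-++ ys₁) ⟩
  suc (length ys₁ + length ys₂)      ≡⟨ +-suc (length ys₁) (length ys₂) ⟨
  length ys₁ + length (x ∷ ys₂)      ≡⟨ length-++ ys₁ ⟨
  length (ys₁ ++ x ∷ ys₂)            ∎
  where
  open ≤-Reasoning
  xs⊆ys₁ys₂ : xs ⊆ ys₁ ++ ys₂
  xs⊆ys₁ys₂ {v} v∈xs with ∈-++⁻ ys₁ (xs⊆ys (there v∈xs))
  ... | inj₁ v∈ys₁ = ∈-++⁺ˡ v∈ys₁
  ... | inj₂ (here refl) = contradiction refl (All.lookup x∉xs v∈xs)
  ... | inj₂ (there v∈ys₂) = ∈-++⁺ʳ ys₁ v∈ys₂

IsDownset : (ℕ → ℕ → Set) → Set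
IsDownset P = ∀ {k m k′ m′} → P k m → k′ ≤ k → m′ ≤ m → P k′ m′

Under : (ℕ → ℕ) → ℕ → ℕ → Set
Under h k m = m < h k

UnderMinusTop : (ℕ → ℕ) → ℕ → ℕ → ℕ → Set
UnderMinusTop h k₀ k m = m < h k × ¬ (k ≡ k₀ × m ≡ h k₀ ∸ 1)

underMinusTop-downset : ∀ {h k₀} → NonIncreasing h → h (suc k₀) < h k₀ → IsDownset (UnderMinusTop h k₀)
underMinusTop-downset {h} {k₀} h↓ drop {k} {m} {k′} {m′} (m<h , not-top) k′≤k m′≤m =
  <-≤-trans (≤-<-trans m′≤m m<h) (nonIncreasing-≤ h↓ k′≤k) , not-top′
  where
  not-top′ : ¬ (k′ ≡ k₀ × m′ ≡ h k₀ ∸ 1)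
  not-top′ (refl , refl) with k ≟ k₀
  ... | yes refl = not-top (refl , ≤-antisym (pred-mono-≤ m<h) m′≤m)
  ... | no k≢k₀ = <-irrefl refl (≤-<-trans m′≤m (<-≤-trans m<h
                    (≤-trans (nonIncreasing-≤ h↓ (≤∧≢⇒< k′≤k (k≢k₀ ∘ sym))) (pred-mono-≤ drop))))

bounded⇒≤ : ∀ {K n} → (∀ {m} → m < K → m < n) → K ≤ n
bounded⇒≤ {zero} _ = z≤n
bounded⇒≤ {suc K} m<K⇒m<n = m<K⇒m<n ≤-refl

module _ {h h′ : ℕ → ℕ} {k₀ : ℕ} (sub : UnderMinusTop h k₀ ⇒ Under h′) where

  underMinusTop-⇒-≤ : ∀ {k} → k ≢ k₀ → h k ≤ h′ k
  underMinusTop-⇒-≤ k≢k₀ = bounded⇒≤ λ m<h → sub (m<h , k≢k₀ ∘ proj₁)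

  underMinusTop-⇒-top : h k₀ ∸ 1 ≤ h′ k₀
  underMinusTop-⇒-top = bounded⇒≤ λ m<h∸1 → sub (<-≤-trans m<h∸1 (m∸n≤m _ 1) , λ (_ , m≡) → <-irrefl m≡ m<h∸1)

lowering-keeps : ∀ {P h h′ k₀} → IsDownset P → P ⇒ Under h → ¬ P k₀ (h k₀ ∸ 1) →
                 (∀ {k} → k ≢ k₀ → h k ≤ h′ k) → h k₀ ∸ 1 ≤ h′ k₀ → P ⇒ Under h′
lowering-keeps {P} {h} {h′} {k₀} P↓ P⊆ ¬top other top {k} {m} p with k ≟ k₀
... | no k≢k₀ = <-≤-trans (P⊆ p) (other k≢k₀)
... | yes refl = <-≤-trans m<top top
  where
  m<top : m < h k₀ ∸ 1
  m<top = ≰⇒> λ top≤m → ¬top (P↓ p ≤-refl top≤m)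

+-∸1-≤ˡ : ∀ a b → (a + b) ∸ 1 ≤ (a ∸ 1) + b
+-∸1-≤ˡ zero b = m∸n≤m b 1
+-∸1-≤ˡ (suc a) b = ≤-refl

+-∸1-≤ʳ : ∀ a b → (a + b) ∸ 1 ≤ a + (b ∸ 1)
+-∸1-≤ʳ a b = subst₂ (λ u v → u ∸ 1 ≤ v) (+-comm b a) (+-comm (b ∸ 1) a) (+-∸1-≤ˡ b a)

module _ {P : ℕ → ℕ → Set} {f g : ℕ → ℕ} {k₀ : ℕ} (P↓ : IsDownset P)
         (P⊆ : P ⇒ Under (λ k → f k + g k)) (¬top : ¬ P k₀ (f k₀ + g k₀ ∸ 1)) where

  lowerˡ-keeps : ∀ {f′} → UnderMinusTop f k₀ ⇒ Under f′ → P ⇒ Under (λ k → f′ k + g k)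
  lowerˡ-keeps sub = lowering-keeps P↓ P⊆ ¬top
    (+-monoˡ-≤ _ ∘ underMinusTop-⇒-≤ sub) (≤-trans (+-∸1-≤ˡ (f k₀) (g k₀)) (+-monoˡ-≤ _ (underMinusTop-⇒-top sub)))

  lowerʳ-keeps : ∀ {g′} → UnderMinusTop g k₀ ⇒ Under g′ → P ⇒ Under (λ k → f k + g′ k)
  lowerʳ-keeps sub = lowering-keeps P↓ P⊆ ¬top
    (+-monoʳ-≤ _ ∘ underMinusTop-⇒-≤ sub) (≤-trans (+-∸1-≤ʳ (f k₀) (g k₀)) (+-monoʳ-≤ _ (underMinusTop-⇒-top sub)))

module _ (f g : ℕ → ℕ) {N : ℕ} (f↓ : NonIncreasing f) (g↓ : NonIncreasing g)
         (f0 : VanishesFrom f N) (g0 : VanishesFrom g N) {P : ℕ → ℕ → Set} (P↓ : IsDownset P) where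

  TopCorner : ℕ → Set
  TopCorner k = (f (suc k) < f k ⊎ g (suc k) < g k) × ¬ P k (f k + g k ∸ 1)

  -- While neither f nor g drops, the next column has the same height, so its top cell
  -- is missing from the downset P as well; the heights vanish from N on.
  private
    search : ∀ fuel k → N ≤ k + fuel → 0 < f k + g k → ¬ P k (f k + g k ∸ 1) → ∃ TopCorner
    search zero k N≤k pos ¬top rewrite +-identityʳ k | f0 k N≤k | g0 k N≤k = contradiction pos (<-irrefl refl)
    search (suc fuel) k N≤k pos ¬top with f (suc k) <? f k | g (suc k) <? g k
    ... | yes drop | _ = k , inj₁ drop , ¬top
    ... | no _ | yes drop = k , inj₂ drop , ¬top
    ... | no f≮ | no g≮ =
      search fuel (suc k) (subst (N ≤_) (+-suc k fuel) N≤k) (subst (0 <_) (sym same) pos)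
        (λ p → ¬top (P↓ p (n≤1+n k) (≤-reflexive (cong (_∸ 1) (sym same)))))
      where
      same : f (suc k) + g (suc k) ≡ f k + g k
      same = cong₂ _+_ (≤-antisym (f↓ k) (≮⇒≥ f≮)) (≤-antisym (g↓ k) (≮⇒≥ g≮))

  findTopCorner : ∀ {k m} → m < f k + g k → ¬ P k m → ∃ TopCorner
  findTopCorner {k} m<h ¬P = search N k (m≤n+m N k) (≤-<-trans z≤n m<h) (λ p → ¬P (P↓ p ≤-refl (pred-mono-≤ m<h)))

record Deletion (profile : Tree → ℕ → ℕ) (t : Tree) (P : ℕ → ℕ → Set) : Set where
  field
    tree    : Tree
    smaller : size tree < size t
    embeds  : Embedding (wordOf tree) (wordOf t)
    keeps   : P ⇒ Under (profile tree)
open Deletion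

under-minDecᵀ : ∀ t {P : ℕ → ℕ → Set} → P ⇒ Under (minDec t) → flip P ⇒ Under (minInc t)
under-minDecᵀ t P⊆ {s} {r} p = to (minDec-conjugate t r s) (P⊆ p)

under-minIncᵀ : ∀ t {Q : ℕ → ℕ → Set} → Q ⇒ Under (minInc t) → flip Q ⇒ Under (minDec t)
under-minIncᵀ t Q⊆ {r} {s} q = from (minDec-conjugate t r s) (Q⊆ q)

deletionᵀ : ∀ {t P} → Deletion minDec t P → Deletion minInc t (flip P)
deletionᵀ D = record { tree = tree D ; smaller = smaller D ; embeds = embeds D
  ; keeps = under-minDecᵀ (tree D) (keeps D) }

deletionᵀ⁻¹ : ∀ {t P} → Deletion minInc t (flip P) → Deletion minDec t P
deletionᵀ⁻¹ D = record { tree = tree D ; smaller = smaller D ; embeds = embeds D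
  ; keeps = under-minIncᵀ (tree D) (keeps D) }

downsetᵀ : ∀ {P} → IsDownset P → IsDownset (flip P)
downsetᵀ P↓ p k′≤k m′≤m = P↓ p m′≤m k′≤k

∸1< : ∀ {n} → 0 < n → n ∸ 1 < n
∸1< (s≤s _) = ≤-refl

delete : ∀ t {P} → IsDownset P → P ⇒ Under (minDec t) → ∀ {r s} → s < minDec t r → ¬ P r s → Deletion minDec t P
deleteᵀ : ∀ t {Q} → IsDownset Q → Q ⇒ Under (minInc t) → ∀ {s r} → r < minInc t s → ¬ Q s r → Deletion minInc t Q

deleteᵀ t Q↓ Q⊆ {s} {r} r< ¬Q =
  deletionᵀ (delete t (downsetᵀ Q↓) (under-minIncᵀ t Q⊆) (from (minDec-conjugate t r s) r<) ¬Q)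

removeTop : ∀ x k₀ → minDec x (suc k₀) < minDec x k₀ → Deletion minDec x (UnderMinusTop (minDec x) k₀)
removeTop x k₀ drop = delete x (underMinusTop-downset (minDec-nonIncreasing x) drop) proj₁
  (∸1< (≤-<-trans z≤n drop)) (λ (_ , not-top) → not-top (refl , refl))

removeTopᵀ : ∀ x k₀ → minInc x (suc k₀) < minInc x k₀ → Deletion minInc x (UnderMinusTop (minInc x) k₀)
removeTopᵀ x k₀ drop = deleteᵀ x (underMinusTop-downset (minInc-nonIncreasing x) drop) proj₁
  (∸1< (≤-<-trans z≤n drop)) (λ (_ , not-top) → not-top (refl , refl))

delete empty _ _ () _
delete single P↓ _ {zero} {zero} _ ¬P = record
  { tree = empty ; smaller = s≤s z≤n ; embeds = embedding-[] _ ; keeps = λ p → contradiction (P↓ p z≤n z≤n) ¬P }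
delete single _ _ {zero} {suc _} (s≤s ()) _
delete single _ _ {suc _} () _
delete (x ⊞ y) P↓ P⊆ s< ¬P
  with findTopCorner (minDec x) (minDec y) (minDec-nonIncreasing x) (minDec-nonIncreasing y)
         (vanishesFrom-mono (minDec-vanishesFrom x) (m≤m+n _ _)) (vanishesFrom-mono (minDec-vanishesFrom y) (m≤n+m _ _))
         P↓ s< ¬P
... | k₀ , inj₁ drop , ¬top = let D = removeTop x k₀ drop in record
  { tree = tree D ⊞ y ; smaller = +-monoˡ-< (size y) (smaller D) ; embeds = embedding-⊞ˡ (tree D) x y (embeds D)
  ; keeps = lowerˡ-keeps P↓ P⊆ ¬top (keeps D) }
... | k₀ , inj₂ drop , ¬top = let D = removeTop y k₀ drop in record
  { tree = x ⊞ tree D ; smaller = +-monoʳ-< (size x) (smaller D) ; embeds = embedding-⊞ʳ x (tree D) y (embeds D)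
  ; keeps = lowerʳ-keeps P↓ P⊆ ¬top (keeps D) }
delete (x ⊟ y) P↓ P⊆ {r} {s} s< ¬P
  with findTopCorner (minInc x) (minInc y) (minInc-nonIncreasing x) (minInc-nonIncreasing y)
         (vanishesFrom-mono (minInc-vanishesFrom x) (m≤m+n _ _)) (vanishesFrom-mono (minInc-vanishesFrom y) (m≤n+m _ _))
         (downsetᵀ P↓) (to (minDec-conjugate (x ⊟ y) r s) s<) ¬P
... | k₀ , inj₁ drop , ¬top = let D = removeTopᵀ x k₀ drop in deletionᵀ⁻¹ record
  { tree = tree D ⊟ y ; smaller = +-monoˡ-< (size y) (smaller D) ; embeds = embedding-⊟ˡ (tree D) x y (embeds D)
  ; keeps = lowerˡ-keeps (downsetᵀ P↓) (under-minDecᵀ (x ⊟ y) P⊆) ¬top (keeps D) }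
... | k₀ , inj₂ drop , ¬top = let D = removeTopᵀ y k₀ drop in deletionᵀ⁻¹ record
  { tree = x ⊟ tree D ; smaller = +-monoʳ-< (size x) (smaller D) ; embeds = embedding-⊟ʳ x (tree D) y (embeds D)
  ; keeps = lowerʳ-keeps (downsetᵀ P↓) (under-minDecᵀ (x ⊟ y) P⊆) ¬top (keeps D) }

length-treeWord : ∀ π t → wordOf t ≡ word π → len π ≡ size t
length-treeWord π t refl = length-wordOf t

module _ (A : Downset) (π : Perm) (t : Tree) (π≡t : wordOf t ≡ word π) (critical : ACritical A π) where
  private
    InA : ℕ → ℕ → Set
    InA r s = (r , s) ∈ elems A

    InA-downset : IsDownset InA
    InA-downset {k} {m} {k′} {m′} = closed A k m k′ m′

    InA⇒under : InA ⇒ Under (minDec t)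
    InA⇒under {r} {s} rs∈A = ≰⇒> λ minDec≤s →
      proj₁ critical (r , s , rs∈A , from (coverable⇔minDec-≤ π t π≡t r s) minDec≤s)

  elems-⊆-diagram : elems A ⊆ diagram t
  elems-⊆-diagram {r , s} rs∈A = from (∈-diagram t r s) (InA⇒under rs∈A)

  diagram-⊆-elems : diagram t ⊆ elems A
  diagram-⊆-elems {r , s} rs∈t with (r , s) ∈? elems A
  ... | yes rs∈A = rs∈A
  ... | no rs∉A with delete t InA-downset InA⇒under (to (∈-diagram t r s) rs∈t) rs∉A
  ... | D with proj₂ critical (treePerm (tree D)) shorter contains
    where
    shorter : len (treePerm (tree D)) < len π
    shorter = subst₂ _<_ (sym (length-wordOf (tree D))) (sym (length-treeWord π t π≡t)) (smaller D)
    contains : Contains π (treePerm (tree D))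
    contains = embedding⇒contains π (treePerm (tree D)) (subst (Embedding (wordOf (tree D))) π≡t (embeds D))
  ... | r′ , s′ , inA , coverable =
    contradiction (to (coverable⇔minDec-≤ (treePerm (tree D)) (tree D) refl r′ s′) coverable) (<⇒≱ (keeps D inA))

separable-critical-length : (A : Downset) (π : Perm) → Separable π → ACritical A π → len π ≡ card A
separable-critical-length A π separable critical with separable⇒tree separable
... | t , π≡t = begin
  len π                ≡⟨ length-treeWord π t π≡t ⟩
  size t               ≡⟨ length-diagram t ⟨
  length (diagram t)   ≡⟨ ≤-antisym (unique-⊆⇒length-≤ (unique-diagram t) (diagram-⊆-elems A π t π≡t critical))
                                    (unique-⊆⇒length-≤ (unique A) (elems-⊆-diagram A π t π≡t critical)) ⟩
  card A               ∎
  where open ≡-Reasoning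

critical-⇔ : ∀ {P Q : Perm → Set} → (∀ τ → P τ ⇔ Q τ) → ∀ π → Critical P π → Critical Q π
critical-⇔ P⇔Q π (¬P , patterns-P) = ¬P ∘ from (P⇔Q _) , λ τ shorter contains → to (P⇔Q τ) (patterns-P τ shorter contains)

columns : (ℕ → ℕ) → ℕ → List (ℕ × ℕ)
columns h zero = []
columns h (suc n) = map (0 ,′_) (upTo (h 0)) ++ map (Product.map₁ suc) (columns (h ∘ suc) n)

∈-columns : ∀ h n r s → (r , s) ∈ columns h n ⇔ (r < n × s < h r)
∈-columns h zero r s = mk⇔ (λ ()) (λ ())
∈-columns h (suc n) r s = mk⇔ to′ from′
  where
  to′ : (r , s) ∈ columns h (suc n) → r < suc n × s < h r
  to′ rs∈ with ∈-++⁻ (map (0 ,′_) (upTo (h 0))) rs∈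
  ... | inj₁ ∈first with ∈-map⁻ (0 ,′_) ∈first
  ...   | _ , s∈ , refl = s≤s z≤n , ∈-upTo⁻ s∈
  to′ rs∈ | inj₂ ∈rest with ∈-map⁻ (Product.map₁ suc) ∈rest
  ...   | (r′ , _) , ∈rest′ , refl = Product.map₁ s≤s (to (∈-columns (h ∘ suc) n r′ s) ∈rest′)
  from′ : r < suc n × s < h r → (r , s) ∈ columns h (suc n)
  from′ (s≤s z≤n , s<h) = ∈-++⁺ˡ (∈-map⁺ (0 ,′_) (∈-upTo⁺ s<h))
  from′ (s≤s (s≤s r<n) , s<h) =
    ∈-++⁺ʳ _ (∈-map⁺ (Product.map₁ suc) (from (∈-columns (h ∘ suc) n _ s) (s≤s r<n , s<h)))

unique-columns : ∀ h n → Unique (columns h n)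
unique-columns h zero = []
unique-columns h (suc n) =
  Unique.++⁺ (Unique.map⁺ (cong proj₂) (Unique.upTo⁺ (h 0)))
              (Unique.map⁺ (λ { {_ , _} {_ , _} refl → refl }) (unique-columns (h ∘ suc) n))
              disjoint
  where
  disjoint : ∀ {v} → ¬ (v ∈ map (0 ,′_) (upTo (h 0)) × v ∈ map (Product.map₁ suc) (columns (h ∘ suc) n))
  disjoint (∈first , ∈rest) with ∈-map⁻ (0 ,′_) ∈first | ∈-map⁻ (Product.map₁ suc) ∈rest
  ... | _ , _ , refl | _ , _ , ()

length-columns-suc : ∀ h n → length (columns h (suc n)) ≡ h 0 + length (columns (h ∘ suc) n)
length-columns-suc h n = trans (length-++ (map (0 ,′_) (upTo (h 0))) {map (Product.map₁ suc) (columns (h ∘ suc) n)})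
  (cong₂ _+_ (trans (length-map (0 ,′_) (upTo (h 0))) (length-upTo (h 0)))
             (length-map (Product.map₁ suc) (columns (h ∘ suc) n)))

columnsDownset : (h : ℕ → ℕ) → NonIncreasing h → ℕ → Downset
columnsDownset h h↓ n = record
  { elems = columns h n
  ; unique = unique-columns h n
  ; closed = λ r s r′ s′ rs∈ r′≤r s′≤s →
      let r<n , s<h = to (∈-columns h n r s) rs∈
      in from (∈-columns h n r′ s′) (≤-<-trans r′≤r r<n , <-≤-trans (≤-<-trans s′≤s s<h) (nonIncreasing-≤ h↓ r′≤r)) }

triangle : ℕ → Downset
triangle k = columnsDownset (λ r → suc k ∸ r) (λ r → ∸-monoʳ-≤ (suc k) (n≤1+n r)) (suc k)

∈-triangle : ∀ k r s → (r , s) ∈ elems (triangle k) ⇔ (r + s ≤ k)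
∈-triangle k r s = ⇔-trans (∈-columns (λ r → suc k ∸ r) (suc k) r s) (mk⇔ to′ from′)
  where
  to′ : r < suc k × s < suc k ∸ r → r + s ≤ k
  to′ (s≤s r≤k , s<) rewrite +-∸-assoc 1 r≤k =
    subst (r + s ≤_) (m+[n∸m]≡n r≤k) (+-monoʳ-≤ r (s≤s⁻¹ s<))
  from′ : r + s ≤ k → r < suc k × s < suc k ∸ r
  from′ r+s≤k rewrite +-∸-assoc 1 (m+n≤o⇒m≤o r r+s≤k) =
    s≤s (m+n≤o⇒m≤o r r+s≤k) , s≤s (subst (_≤ k ∸ r) (m+n∸m≡n r s) (∸-monoˡ-≤ r r+s≤k))

card-triangle : ∀ k → card (triangle k) ≡ (k + 2) C 2
card-triangle zero = refl
card-triangle (suc k) = begin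
  length (columns (λ r → suc (suc k) ∸ r) (suc (suc k)))   ≡⟨ length-columns-suc (λ r → suc (suc k) ∸ r) (suc k) ⟩
  2 + k + card (triangle k)                                 ≡⟨ cong₂ _+_ (sym (trans (nC1≡n (k + 2)) (+-comm k 2))) (card-triangle k) ⟩
  (k + 2) C 1 + (k + 2) C 2                                 ≡⟨ nCk+nC[k+1]≡[n+1]C[k+1] (k + 2) 1 ⟩
  (suc k + 2) C 2                                           ∎
  where open ≡-Reasoning

kCoverable⇔triangle : ∀ k τ → KCoverable k τ ⇔ ACoverable (triangle k) τ
kCoverable⇔triangle k τ = mk⇔
  (λ (r , s , r+s≡k , κ) → r , s , from (∈-triangle k r s) (≤-reflexive r+s≡k) , κ)
  (λ (r , s , rs∈ , κ) → let r+s≤k = to (∈-triangle k r s) rs∈ ; r≤k = m+n≤o⇒m≤o r r+s≤k in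
     r , k ∸ r , m+[n∸m]≡n r≤k ,
     coverable-mono τ ≤-refl (subst (_≤ k ∸ r) (m+n∸m≡n r s) (∸-monoˡ-≤ r r+s≤k)) κ)

rectangle : ℕ → ℕ → Downset
rectangle r s = columnsDownset (λ _ → suc s) (λ _ → ≤-refl) (suc r)

card-rectangle : ∀ r s → card (rectangle r s) ≡ (r + 1) * (s + 1)
card-rectangle r s = trans (length-columns-const (suc r)) (cong₂ _*_ (+-comm 1 r) (+-comm 1 s))
  where
  length-columns-const : ∀ n → length (columns (λ _ → suc s) n) ≡ n * suc s
  length-columns-const zero = refl
  length-columns-const (suc n) = trans (length-columns-suc (λ _ → suc s) n) (cong (suc s +_) (length-columns-const n))

coverable⇔rectangle : ∀ r s τ → Coverable r s τ ⇔ ACoverable (rectangle r s) τ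
coverable⇔rectangle r s τ = mk⇔
  (λ κ → r , s , from (∈-columns (λ _ → suc s) (suc r) r s) (≤-refl , ≤-refl) , κ)
  (λ (r′ , s′ , rs∈ , κ) → let r′<r+1 , s′<s+1 = to (∈-columns (λ _ → suc s) (suc r) r′ s′) rs∈ in
     coverable-mono τ (s≤s⁻¹ r′<r+1) (s≤s⁻¹ s′<s+1) κ)

corollary12 : ((A : Downset) (π : Perm) → Separable π → ACritical A π → len π ≡ card A)
    × ((k : ℕ) (π : Perm) → Separable π → KCritical k π → len π ≡ (k + 2) C 2)
    × ((r s : ℕ) (π : Perm) → Separable π → RSCritical r s π → len π ≡ (r + 1) * (s + 1))
corollary12 = separable-critical-length ,
  (λ k π separable critical → trans
     (separable-critical-length (triangle k) π separable (critical-⇔ (kCoverable⇔triangle k) π critical))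
     (card-triangle k)) ,
  (λ r s π separable critical → trans
     (separable-critical-length (rectangle r s) π separable (critical-⇔ (coverable⇔rectangle r s) π critical))
     (card-rectangle r s))
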